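{- For a finite simple graph $G$ the following are equivalent: (i) $G$ is a König–Egerváry graph; (ii) for every $S\in\Omega(G)$ there exists an independent set $A$ of $G$ such that $S\cup A$ is critical; (iii) there exist $S\in\Omega(G)$ and an independent set $A$ of $G$ such that $S\cup A$ is critical.
   Context: For $X\subseteq V(G)$, $N(X)$ is the set of vertices adjacent to some vertex of $X$, $d(X)=|X|-|N(X)|$, $d(G)=\max\{d(X):X\subseteq V(G)\}$, and $X$ is critical if $d(X)=d(G)$. An independent set is a set of pairwise non-adjacent vertices. $\Omega(G)$ is the family of maximum independent sets; $\alpha(G)$ the independence number; $\mu(G)$ the matching number. $G$ is König–Egerváry if $\alpha(G)+\mu(G)=|V(G)|$. -}

module Defs where

open import Data.Nat using (ℕ; _+_; _≤_)
open import Data.Integer as ℤ using (ℤ; +_; _-_)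
open import Data.Bool using (Bool; true; false)
open import Data.Bool.Properties using () renaming (_≟_ to _≟ᵇ_)
open import Data.Fin using (Fin)
open import Data.Fin.Subset using (Subset; _∈_; ∣_∣)
open import Data.Fin.Subset.Properties using (_∈?_)
open import Data.Fin.Properties using (any?)
open import Data.Vec using (tabulate)
open import Data.List using (List; length; _∷_; []; concatMap)
open import Data.List.Relation.Unary.All using (All)
open import Data.List.Relation.Unary.Unique.Propositional using (Unique)
open import Data.Product using (_×_; _,_; Σ; ∃)
open import Relation.Nullary using (does)
open import Relation.Nullary.Decidable using (_×-dec_)
open import Relation.Binary.PropositionalEquality using (_≡_)

record Graph : Set where
  field
    n      : ℕ
    adj    : Fin n → Fin n → Bool
    sym    : ∀ u v → adj u v ≡ adj v u
    irrefl : ∀ v → adj v v ≡ false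

module _ (G : Graph) where
  open Graph G

  N : Subset n → Subset n
  N X = tabulate (λ v → does (any? (λ u → (u ∈? X) ×-dec (adj u v ≟ᵇ true))))

  d : Subset n → ℤ
  d X = + ∣ X ∣ - + ∣ N X ∣

  Critical : Subset n → Set
  Critical X = ∀ (Y : Subset n) → d Y ℤ.≤ d X

  Independent : Subset n → Set
  Independent S = ∀ u v → u ∈ S → v ∈ S → adj u v ≡ false

  MaxIndependent : Subset n → Set
  MaxIndependent S = Independent S × (∀ T → Independent T → ∣ T ∣ ≤ ∣ S ∣)

  endpoints : List (Fin n × Fin n) → List (Fin n)
  endpoints = concatMap (λ { (u , v) → u ∷ v ∷ [] })

  IsMatching : List (Fin n × Fin n) → Set
  IsMatching M = All (λ { (u , v) → adj u v ≡ true }) M × Unique (endpoints M)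

  MaxMatching : List (Fin n × Fin n) → Set
  MaxMatching M = IsMatching M × (∀ M′ → IsMatching M′ → length M′ ≤ length M)

  KönigEgervary : Set
  KönigEgervary = Σ (Subset n) λ S → Σ (List (Fin n × Fin n)) λ M →
    MaxIndependent S × MaxMatching M × (∣ S ∣ + length M ≡ n)

-- (i) ⇒ (ii) with A = ∅: for any matching M and any Y, the partner map of M sends the
-- matched vertices of Y injectively into N(Y), so |Y| + 2|M| ≤ n + |N(Y)|.  If α + μ = n
-- and S is maximum independent then N(S) = V ∖ S has μ elements, and the inequality for a
-- maximum matching reads d(Y) ≤ α − μ = d(S).
--
-- (iii) ⇒ (i): put B = V ∖ S and A′ = A ∩ B.  For T ⊆ B, comparing d(S ∪ T) ≤ d(S ∪ A)
-- gives |T| + |N(A′) ∩ S| ≤ |A′| + |N(T) ∩ S|, and maximality of S (the set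
-- A′ ∪ (S ∖ N(A′)) is independent) gives |A′| ≤ |N(A′) ∩ S|.  So Hall's condition holds
-- for B into S, and Hall's theorem yields a matching of size |B| = n − α; it is maximum
-- because every edge meets B.
--
-- (ii) ⇒ (iii): a maximum independent set exists.

module Submission where

open import Defs
open import Data.Nat using (ℕ; zero; suc; _+_; _∸_; _≤_; _<_; z≤n; s≤s; _<?_)
open import Data.Nat.Properties
open import Algebra.Properties.CommutativeSemigroup +-commutativeSemigroup using (interchange)
open import Data.Integer as ℤ using (ℤ)
import Data.Integer.Properties as ℤ
open import Data.Integer.Tactic.RingSolver using (solve-∀)
open import Data.Fin using (Fin; zero; suc)
open import Data.Fin.Properties using (any?; all?) renaming (_≟_ to _≟ᶠ_; suc-injective to sucᶠ-injective)
open import Data.Fin.Subset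
open import Data.Fin.Subset.Properties
open import Data.Bool using (true; false; if_then_else_)
open import Data.Bool.Properties using () renaming (_≟_ to _≟ᵇ_)
open import Data.Vec using (_∷_; []; here; there; tabulate)
open import Data.Vec.Properties using (lookup∘tabulate; []=⇒lookup; lookup⇒[]=)
open import Data.Vec.Functional using (updateAt)
open import Data.Vec.Functional.Properties using (updateAt-updates; updateAt-minimal)
open import Data.List using (List; []; _∷_; length; map; filter; allFin)
open import Data.List.Relation.Unary.All as All using (All; []; _∷_)
open import Data.List.Relation.Unary.Any using () renaming (here to hereₗ; there to thereₗ)
open import Data.List.Membership.Propositional using () renaming (_∈_ to _∈ₗ_)
open import Data.List.Relation.Unary.Unique.Propositional using (Unique; []; _∷_)
open import Data.List.Relation.Unary.All.Properties using (¬Any⇒All¬; all-filter)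
open import Data.List.Relation.Unary.Unique.Propositional.Properties using (filter⁺; allFin⁺)
open import Data.List.Membership.Propositional.Properties using (∈-filter⁺; ∈-allFin)
open import Data.List.Properties using (length-map)
open import Data.Product using (_×_; _,_; proj₁; proj₂; Σ; ∃)
open import Data.Sum using (_⊎_; inj₁; inj₂; [_,_]′)
open import Relation.Binary.PropositionalEquality
open import Relation.Nullary using (¬_; Dec; yes; no; does; contradiction)
open import Relation.Nullary.Decidable using (dec-true; dec-false; _×-dec_; _→-dec_; ¬?)
open import Relation.Unary using (Pred; Decidable)
open import Function.Bundles using (_⇔_; mk⇔; Equivalence)
open import Function using (id; _∘_; case_of_)
open import Induction.WellFounded using (Acc; acc)
open import Data.Nat.Induction using (<-wellFounded)

-- Finite sets

x∈p─q⇒x∉q : ∀ {n} (p q : Subset n) {x} → x ∈ p ─ q → x ∉ q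
x∈p─q⇒x∉q (_ ∷ p) (inside ∷ q) {zero}  ()        here
x∈p─q⇒x∉q (_ ∷ p) (_      ∷ q) {suc x} (there m) (there x∈q) = x∈p─q⇒x∉q p q m x∈q

∈tabulate⁺ : ∀ {n ℓ} {P : Pred (Fin n) ℓ} (P? : Decidable P) {v} → P v → v ∈ tabulate (does ∘ P?)
∈tabulate⁺ P? {v} Pv = lookup⇒[]= v _ (trans (lookup∘tabulate _ v) (dec-true (P? v) Pv))

∈tabulate⁻ : ∀ {n ℓ} {P : Pred (Fin n) ℓ} (P? : Decidable P) {v} → v ∈ tabulate (does ∘ P?) → P v
∈tabulate⁻ P? {v} v∈ with P? v | trans (sym (lookup∘tabulate _ v)) ([]=⇒lookup v∈)
... | yes Pv | _ = Pv

∣p∪q∣+∣p∩q∣≡∣p∣+∣q∣ : ∀ {n} (p q : Subset n) → ∣ p ∪ q ∣ + ∣ p ∩ q ∣ ≡ ∣ p ∣ + ∣ q ∣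
∣p∪q∣+∣p∩q∣≡∣p∣+∣q∣ []            []            = refl
∣p∪q∣+∣p∩q∣≡∣p∣+∣q∣ (inside  ∷ p) (inside  ∷ q) =
  cong suc (trans (+-suc _ _) (trans (cong suc (∣p∪q∣+∣p∩q∣≡∣p∣+∣q∣ p q)) (sym (+-suc _ _))))
∣p∪q∣+∣p∩q∣≡∣p∣+∣q∣ (inside  ∷ p) (outside ∷ q) = cong suc (∣p∪q∣+∣p∩q∣≡∣p∣+∣q∣ p q)
∣p∪q∣+∣p∩q∣≡∣p∣+∣q∣ (outside ∷ p) (inside  ∷ q) =
  trans (cong suc (∣p∪q∣+∣p∩q∣≡∣p∣+∣q∣ p q)) (sym (+-suc _ _))
∣p∪q∣+∣p∩q∣≡∣p∣+∣q∣ (outside ∷ p) (outside ∷ q) = ∣p∪q∣+∣p∩q∣≡∣p∣+∣q∣ p q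

∣p∪q∣≤∣p∣+∣q∣ : ∀ {n} (p q : Subset n) → ∣ p ∪ q ∣ ≤ ∣ p ∣ + ∣ q ∣
∣p∪q∣≤∣p∣+∣q∣ p q = ≤-trans (m≤m+n _ _) (≤-reflexive (∣p∪q∣+∣p∩q∣≡∣p∣+∣q∣ p q))

Disjoint : ∀ {n} → Subset n → Subset n → Set
Disjoint p q = ∀ {x} → x ∈ p → x ∉ q

disjoint⇒∣p∣+∣q∣≤∣p∪q∣ : ∀ {n} (p q : Subset n) → Disjoint p q → ∣ p ∣ + ∣ q ∣ ≤ ∣ p ∪ q ∣
disjoint⇒∣p∣+∣q∣≤∣p∪q∣ {n} p q p#q = begin
  ∣ p ∣ + ∣ q ∣          ≡⟨ ∣p∪q∣+∣p∩q∣≡∣p∣+∣q∣ p q ⟨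
  ∣ p ∪ q ∣ + ∣ p ∩ q ∣  ≤⟨ +-monoʳ-≤ ∣ p ∪ q ∣ (p⊆q⇒∣p∣≤∣q∣ p∩q⊆⊥) ⟩
  ∣ p ∪ q ∣ + ∣ ⊥ {n} ∣  ≡⟨ cong (∣ p ∪ q ∣ +_) (∣⊥∣≡0 n) ⟩
  ∣ p ∪ q ∣ + 0          ≡⟨ +-identityʳ _ ⟩
  ∣ p ∪ q ∣              ∎
  where
  open ≤-Reasoning
  p∩q⊆⊥ : p ∩ q ⊆ ⊥ {n}
  p∩q⊆⊥ x∈p∩q = let x∈p , x∈q = x∈p∩q⁻ p q x∈p∩q in contradiction x∈q (p#q x∈p)

∣p∣≤1+∣p-x∣ : ∀ {n} (p : Subset n) (x : Fin n) → ∣ p ∣ ≤ suc ∣ p - x ∣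
∣p∣≤1+∣p-x∣ p x = begin
  ∣ p ∣                    ≤⟨ p⊆q⇒∣p∣≤∣q∣ p⊆[p-x]∪x ⟩
  ∣ (p - x) ∪ ⁅ x ⁆ ∣      ≤⟨ ∣p∪q∣≤∣p∣+∣q∣ (p - x) ⁅ x ⁆ ⟩
  ∣ p - x ∣ + ∣ ⁅ x ⁆ ∣    ≡⟨ cong (∣ p - x ∣ +_) (∣⁅x⁆∣≡1 x) ⟩
  ∣ p - x ∣ + 1            ≡⟨ +-comm _ 1 ⟩
  suc ∣ p - x ∣            ∎
  where
  open ≤-Reasoning
  p⊆[p-x]∪x : p ⊆ (p - x) ∪ ⁅ x ⁆
  p⊆[p-x]∪x {y} y∈p with y ≟ᶠ x
  ... | yes refl = q⊆p∪q (p - x) ⁅ x ⁆ (x∈⁅x⁆ x)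
  ... | no  y≢x  = p⊆p∪q ⁅ x ⁆ (x∈p∧x≢y⇒x∈p-y y∈p y≢x)

∣∁p∣+∣p∣≡n : ∀ {n} (p : Subset n) → ∣ ∁ p ∣ + ∣ p ∣ ≡ n
∣∁p∣+∣p∣≡n p = trans (cong (_+ ∣ p ∣) (∣∁p∣≡n∸∣p∣ p)) (m∸n+n≡m (∣p∣≤n p))

maximum-subset : ∀ {n ℓ} {P : Pred (Subset n) ℓ} → Decidable P → ∀ {S₀} → P S₀ →
                 ∃ λ S → P S × ∀ T → P T → ∣ T ∣ ≤ ∣ S ∣
maximum-subset {n} {P = P} P? {S₀} PS₀ = search S₀ PS₀ (<-wellFounded (n ∸ ∣ S₀ ∣))
  where
  search : ∀ S → P S → Acc _<_ (n ∸ ∣ S ∣) → ∃ λ S → P S × ∀ T → P T → ∣ T ∣ ≤ ∣ S ∣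
  search S PS (acc rec) with anySubset? (λ T → P? T ×-dec (∣ S ∣ <? ∣ T ∣))
  ... | yes (T , PT , ∣S∣<∣T∣) = search T PT (rec (∸-monoʳ-< ∣S∣<∣T∣ (∣p∣≤n T)))
  ... | no  ¬larger            = S , PS , λ T PT → ≮⇒≥ λ ∣S∣<∣T∣ → ¬larger (T , PT , ∣S∣<∣T∣)

InjectiveOn : ∀ {k m} → Subset k → (Fin k → Fin m) → Set
InjectiveOn P f = ∀ {x y} → x ∈ P → y ∈ P → f x ≡ f y → x ≡ y

injection⇒∣p∣≤∣q∣ : ∀ {k m} (P : Subset k) (Q : Subset m) (f : Fin k → Fin m) →
                    (∀ {x} → x ∈ P → f x ∈ Q) → InjectiveOn P f → ∣ P ∣ ≤ ∣ Q ∣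
injection⇒∣p∣≤∣q∣ []            Q f f[P]⊆Q f-inj = z≤n
injection⇒∣p∣≤∣q∣ (outside ∷ P) Q f f[P]⊆Q f-inj =
  injection⇒∣p∣≤∣q∣ P Q (f ∘ suc) (f[P]⊆Q ∘ there)
    (λ x∈P y∈P → sucᶠ-injective ∘ f-inj (there x∈P) (there y∈P))
injection⇒∣p∣≤∣q∣ (inside ∷ P) Q f f[P]⊆Q f-inj = begin-strict
  ∣ P ∣             ≤⟨ injection⇒∣p∣≤∣q∣ P (Q - f zero) (f ∘ suc) f[P]⊆Q-f0
                         (λ x∈P y∈P → sucᶠ-injective ∘ f-inj (there x∈P) (there y∈P)) ⟩
  ∣ Q - f zero ∣    <⟨ x∈p⇒∣p-x∣<∣p∣ (f[P]⊆Q here) ⟩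
  ∣ Q ∣             ∎
  where
  open ≤-Reasoning
  f[P]⊆Q-f0 : ∀ {x} → x ∈ P → f (suc x) ∈ Q - f zero
  f[P]⊆Q-f0 x∈P = x∈p∧x≢y⇒x∈p-y (f[P]⊆Q (there x∈P)) (λ eq → case f-inj (there x∈P) here eq of λ ())

length≤∣Q∣ : ∀ {n} {xs : List (Fin n)} (Q : Subset n) → Unique xs → All (_∈ Q) xs → length xs ≤ ∣ Q ∣
length≤∣Q∣ Q [] [] = z≤n
length≤∣Q∣ {xs = x ∷ xs} Q (x≢xs ∷ xs!) (x∈Q ∷ xs⊆Q) =
  <-≤-trans (s≤s (length≤∣Q∣ (Q - x) xs! xs⊆Q-x)) (x∈p⇒∣p-x∣<∣p∣ x∈Q)
  where
  xs⊆Q-x : All (_∈ Q - x) xs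
  xs⊆Q-x = All.zipWith (λ (x≢y , y∈Q) → x∈p∧x≢y⇒x∈p-y y∈Q (x≢y ∘ sym)) (x≢xs , xs⊆Q)

∣P∣≤length : ∀ {n} (P : Subset n) (xs : List (Fin n)) → (∀ {x} → x ∈ P → x ∈ₗ xs) → ∣ P ∣ ≤ length xs
∣P∣≤length {n} P [] P⊆[] =
  ≤-trans (p⊆q⇒∣p∣≤∣q∣ {q = ⊥} (λ x∈P → case P⊆[] x∈P of λ ())) (≤-reflexive (∣⊥∣≡0 n))
∣P∣≤length P (x ∷ xs) P⊆x∷xs = ≤-trans (∣p∣≤1+∣p-x∣ P x) (s≤s (∣P∣≤length (P - x) xs P-x⊆xs))
  where
  P-x⊆xs : ∀ {y} → y ∈ P - x → y ∈ₗ xs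
  P-x⊆xs y∈P-x with P⊆x∷xs (p─q⊆p P ⁅ x ⁆ y∈P-x)
  ... | hereₗ refl  = contradiction (x∈⁅x⁆ x) (x∈p─q⇒x∉q P ⁅ x ⁆ y∈P-x)
  ... | thereₗ y∈xs = y∈xs

sumᶠ : ∀ {k} → (Fin k → ℕ) → ℕ
sumᶠ {zero}  f = 0
sumᶠ {suc k} f = f zero + sumᶠ (f ∘ suc)

sumᶠ-mono-≤ : ∀ {k} {f g : Fin k → ℕ} → (∀ i → f i ≤ g i) → sumᶠ f ≤ sumᶠ g
sumᶠ-mono-≤ {zero}  f≤g = z≤n
sumᶠ-mono-≤ {suc k} f≤g = +-mono-≤ (f≤g zero) (sumᶠ-mono-≤ (f≤g ∘ suc))

sumᶠ-mono-< : ∀ {k} {f g : Fin k → ℕ} → (∀ i → f i ≤ g i) → ∀ i → f i < g i → sumᶠ f < sumᶠ g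
sumᶠ-mono-< {suc k} f≤g zero    fi<gi = +-mono-<-≤ fi<gi (sumᶠ-mono-≤ (f≤g ∘ suc))
sumᶠ-mono-< {suc k} f≤g (suc i) fi<gi = +-mono-≤-< (f≤g zero) (sumᶠ-mono-< (f≤g ∘ suc) i fi<gi)

-- Hall's theorem

Family : ℕ → Set
Family n = Fin n → Subset n

module _ {n : ℕ} where

  InImage : Family n → Subset n → Fin n → Set
  InImage R T v = ∃ λ u → u ∈ T × v ∈ R u

  inImage? : ∀ R T → Decidable (InImage R T)
  inImage? R T v = any? λ u → (u ∈? T) ×-dec (v ∈? R u)

  image : Family n → Subset n → Subset n
  image R T = tabulate (does ∘ inImage? R T)

  ∈image⁺ : ∀ (R : Family n) {T u v} → u ∈ T → v ∈ R u → v ∈ image R T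
  ∈image⁺ R {T} u∈T v∈Ru = ∈tabulate⁺ (inImage? R T) (_ , u∈T , v∈Ru)

  ∈image⁻ : ∀ (R : Family n) {T v} → v ∈ image R T → InImage R T v
  ∈image⁻ R {T} = ∈tabulate⁻ (inImage? R T)

  image-mono : ∀ {R R′ : Family n} {T T′} → T ⊆ T′ → (∀ {u} → u ∈ T → R u ⊆ R′ u) → image R T ⊆ image R′ T′
  image-mono {R} {R′} T⊆T′ R⊆R′ v∈ with ∈image⁻ R v∈
  ... | u , u∈T , v∈Ru = ∈image⁺ R′ (T⊆T′ u∈T) (R⊆R′ u∈T v∈Ru)

  weight : Family n → ℕ
  weight R = sumᶠ (∣_∣ ∘ R)

  delete : Family n → Fin n → Fin n → Family n
  delete R x y = updateAt R x (_- y)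

  delete-≢ : ∀ (R : Family n) {x y u} → u ≢ x → delete R x y u ≡ R u
  delete-≢ R {x} {u = u} u≢x = updateAt-minimal u x R u≢x

  ⊆-delete : ∀ (R : Family n) {x y u} → u ≢ x → R u ⊆ delete R x y u
  ⊆-delete R u≢x = subst (_ ⊆_) (sym (delete-≢ R u≢x)) id

  delete-≡ : ∀ (R : Family n) x y → delete R x y x ≡ R x - y
  delete-≡ R x y = updateAt-updates x R

  ∈delete : ∀ (R : Family n) {x y v} → v ∈ R x → v ≢ y → v ∈ delete R x y x
  ∈delete R {x} {y} v∈Rx v≢y = subst (_ ∈_) (sym (delete-≡ R x y)) (x∈p∧x≢y⇒x∈p-y v∈Rx v≢y)

  delete-⊆ : ∀ (R : Family n) x y u → delete R x y u ⊆ R u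
  delete-⊆ R x y u with u ≟ᶠ x
  ... | yes refl rewrite delete-≡ R x y = p─q⊆p (R x) ⁅ y ⁆
  ... | no  u≢x  rewrite delete-≢ R {y = y} u≢x = id

  weight-delete : ∀ (R : Family n) {x y} → y ∈ R x → weight (delete R x y) < weight R
  weight-delete R {x} {y} y∈Rx = sumᶠ-mono-< (λ u → p⊆q⇒∣p∣≤∣q∣ (delete-⊆ R x y u)) x ∣Rx-y∣<∣Rx∣
    where
    ∣Rx-y∣<∣Rx∣ : ∣ delete R x y x ∣ < ∣ R x ∣
    ∣Rx-y∣<∣Rx∣ rewrite delete-≡ R x y = x∈p⇒∣p-x∣<∣p∣ y∈Rx

  image-∪⊆image-deletes : ∀ (R : Family n) {x y₁ y₂ T₁ T₂} → y₁ ≢ y₂ → x ∈ T₁ → x ∈ T₂ →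
                          image R (T₁ ∪ T₂) ⊆ image (delete R x y₁) T₁ ∪ image (delete R x y₂) T₂
  image-∪⊆image-deletes R {x} {y₁} {y₂} {T₁} {T₂} y₁≢y₂ x∈T₁ x∈T₂ {v} v∈ with ∈image⁻ R v∈
  ... | u , u∈T₁∪T₂ , v∈Ru with u ≟ᶠ x
  ...   | yes refl with v ≟ᶠ y₁
  ...     | yes refl = x∈p∪q⁺ (inj₂ (∈image⁺ (delete R x y₂) x∈T₂ (∈delete R v∈Ru y₁≢y₂)))
  ...     | no  v≢y₁ = x∈p∪q⁺ (inj₁ (∈image⁺ (delete R x y₁) x∈T₁ (∈delete R v∈Ru v≢y₁)))
  image-∪⊆image-deletes R {x} {y₁} {y₂} {T₁} {T₂} _ _ _ v∈ | u , u∈T₁∪T₂ , v∈Ru | no u≢x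
    with x∈p∪q⁻ T₁ T₂ u∈T₁∪T₂
  ...   | inj₁ u∈T₁ = x∈p∪q⁺ (inj₁ (∈image⁺ (delete R x y₁) u∈T₁ (⊆-delete R u≢x v∈Ru)))
  ...   | inj₂ u∈T₂ = x∈p∪q⁺ (inj₂ (∈image⁺ (delete R x y₂) u∈T₂ (⊆-delete R u≢x v∈Ru)))

  image-∩⊆image-deletes : ∀ (R : Family n) {x y₁ y₂} T₁ T₂ →
                          image R ((T₁ ∩ T₂) - x) ⊆ image (delete R x y₁) T₁ ∩ image (delete R x y₂) T₂
  image-∩⊆image-deletes R {x} T₁ T₂ v∈ =
    x∈p∩q⁺ ( image-mono (proj₁ ∘ x∈p∩q⁻ T₁ T₂ ∘ I⊆T₁∩T₂) R⊆R-x v∈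
           , image-mono (proj₂ ∘ x∈p∩q⁻ T₁ T₂ ∘ I⊆T₁∩T₂) R⊆R-x v∈)
    where
    I⊆T₁∩T₂ : (T₁ ∩ T₂) - x ⊆ T₁ ∩ T₂
    I⊆T₁∩T₂ = p─q⊆p (T₁ ∩ T₂) ⁅ x ⁆
    R⊆R-x : ∀ {y u} → u ∈ (T₁ ∩ T₂) - x → R u ⊆ delete R x y u
    R⊆R-x u∈ = ⊆-delete R λ { refl → x∈p─q⇒x∉q (T₁ ∩ T₂) ⁅ x ⁆ u∈ (x∈⁅x⁆ x) }

module Hall {n : ℕ} (B : Subset n) where

  HallCondition : Family n → Set
  HallCondition R = ∀ T → T ⊆ B → ∣ T ∣ ≤ ∣ image R T ∣

  Deficient : Family n → Subset n → Set
  Deficient R T = T ⊆ B × ∣ image R T ∣ < ∣ T ∣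

  hallCondition? : ∀ R → HallCondition R ⊎ ∃ (Deficient R)
  hallCondition? R with anySubset? (λ T → (T ⊆? B) ×-dec (∣ image R T ∣ <? ∣ T ∣))
  ... | yes deficient = inj₂ deficient
  ... | no  ¬deficient = inj₁ (λ T T⊆B → ≮⇒≥ (λ lt → ¬deficient (T , T⊆B , lt)))

  SDR : Family n → Set
  SDR R = Σ (Fin n → Fin n) λ g → (∀ {x} → x ∈ B → g x ∈ R x) × InjectiveOn B g

  ∈-deficient-delete : ∀ {R T x y} → HallCondition R → Deficient (delete R x y) T → x ∈ T
  ∈-deficient-delete {R} {T} {x} {y} hall (T⊆B , deficient) with x ∈? T
  ... | yes x∈T = x∈T
  ... | no  x∉T = contradiction (≤-trans (hall T T⊆B) (p⊆q⇒∣p∣≤∣q∣ image⊆)) (<⇒≱ deficient)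
    where
    image⊆ : image R T ⊆ image (delete R x y) T
    image⊆ = image-mono id λ u∈T → ⊆-delete R λ { refl → x∉T u∈T }

  -- Rado's argument: if x ∈ B has two representatives y₁ ≢ y₂, deleting one of the two
  -- edges keeps Hall's condition, since two deficient sets would contradict the
  -- submodularity of T ↦ ∣ image R T ∣.
  deficient-deletes⇒⊥ : ∀ {R T₁ T₂ x y₁ y₂} → HallCondition R → y₁ ≢ y₂ →
                        Deficient (delete R x y₁) T₁ → ¬ Deficient (delete R x y₂) T₂
  deficient-deletes⇒⊥ {R} {T₁} {T₂} {x} {y₁} {y₂} hall y₁≢y₂ d₁@(T₁⊆B , ∣U₁∣<∣T₁∣) d₂@(T₂⊆B , ∣U₂∣<∣T₂∣) =
    <-irrefl refl contradictory
    where
    x∈T₁ : x ∈ T₁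
    x∈T₁ = ∈-deficient-delete hall d₁
    x∈T₂ : x ∈ T₂
    x∈T₂ = ∈-deficient-delete hall d₂
    U₁ U₂ I : Subset n
    U₁ = image (delete R x y₁) T₁
    U₂ = image (delete R x y₂) T₂
    I = (T₁ ∩ T₂) - x

    T₁∪T₂⊆B : T₁ ∪ T₂ ⊆ B
    T₁∪T₂⊆B u∈ = [ T₁⊆B , T₂⊆B ]′ (x∈p∪q⁻ T₁ T₂ u∈)

    I⊆B : I ⊆ B
    I⊆B = T₁⊆B ∘ proj₁ ∘ x∈p∩q⁻ T₁ T₂ ∘ p─q⊆p (T₁ ∩ T₂) ⁅ x ⁆

    contradictory : suc (∣ U₁ ∣ + ∣ U₂ ∣) < suc (∣ U₁ ∣ + ∣ U₂ ∣)
    contradictory = begin-strict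
      suc (∣ U₁ ∣ + ∣ U₂ ∣)           <⟨ s≤s (≤-reflexive (sym (+-suc ∣ U₁ ∣ ∣ U₂ ∣))) ⟩
      suc ∣ U₁ ∣ + suc ∣ U₂ ∣         ≤⟨ +-mono-≤ ∣U₁∣<∣T₁∣ ∣U₂∣<∣T₂∣ ⟩
      ∣ T₁ ∣ + ∣ T₂ ∣                 ≡⟨ ∣p∪q∣+∣p∩q∣≡∣p∣+∣q∣ T₁ T₂ ⟨
      ∣ T₁ ∪ T₂ ∣ + ∣ T₁ ∩ T₂ ∣       ≤⟨ +-monoʳ-≤ ∣ T₁ ∪ T₂ ∣ (∣p∣≤1+∣p-x∣ (T₁ ∩ T₂) x) ⟩
      ∣ T₁ ∪ T₂ ∣ + suc ∣ I ∣         ≤⟨ +-mono-≤ (hall (T₁ ∪ T₂) T₁∪T₂⊆B) (s≤s (hall I I⊆B)) ⟩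
      ∣ image R (T₁ ∪ T₂) ∣ + suc ∣ image R I ∣
                                       ≤⟨ +-mono-≤ (p⊆q⇒∣p∣≤∣q∣ (image-∪⊆image-deletes R y₁≢y₂ x∈T₁ x∈T₂))
                                             (s≤s (p⊆q⇒∣p∣≤∣q∣ (image-∩⊆image-deletes R {y₁ = y₁} {y₂} T₁ T₂))) ⟩
      ∣ U₁ ∪ U₂ ∣ + suc ∣ U₁ ∩ U₂ ∣   ≡⟨ +-suc _ _ ⟩
      suc (∣ U₁ ∪ U₂ ∣ + ∣ U₁ ∩ U₂ ∣) ≡⟨ cong suc (∣p∪q∣+∣p∩q∣≡∣p∣+∣q∣ U₁ U₂) ⟩
      suc (∣ U₁ ∣ + ∣ U₂ ∣)           ∎
      where open ≤-Reasoning

  Ambiguous : Family n → Set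
  Ambiguous R = ∃ λ x → x ∈ B × ∃ λ y₁ → ∃ λ y₂ → y₁ ≢ y₂ × y₁ ∈ R x × y₂ ∈ R x

  ambiguous? : ∀ R → Dec (Ambiguous R)
  ambiguous? R = any? λ x → (x ∈? B) ×-dec any? λ y₁ → any? λ y₂ →
                   (¬? (y₁ ≟ᶠ y₂)) ×-dec (y₁ ∈? R x) ×-dec (y₂ ∈? R x)

  module Unambiguous (R : Family n) (hall : HallCondition R) (unambiguous : ¬ Ambiguous R) where

    representative : ∀ x → Dec (∃ (_∈ R x)) → Fin n
    representative x (yes (y , _)) = y
    representative x (no  _)       = x  -- junk, ruled out on B by Hall's condition

    g : Fin n → Fin n
    g x = representative x (any? (_∈? R x))

    g-∈ : ∀ {x} → x ∈ B → g x ∈ R x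
    g-∈ {x} x∈B with any? (_∈? R x)
    ... | yes (_ , y∈Rx) = y∈Rx
    ... | no  Rx-empty   = contradiction 1≤0 λ ()
      where
      ⁅x⁆⊆B : ⁅ x ⁆ ⊆ B
      ⁅x⁆⊆B u∈⁅x⁆ rewrite x∈⁅y⁆⇒x≡y x u∈⁅x⁆ = x∈B
      image⊆⊥ : image R ⁅ x ⁆ ⊆ ⊥
      image⊆⊥ v∈ with ∈image⁻ R v∈
      ... | u , u∈⁅x⁆ , v∈Ru rewrite x∈⁅y⁆⇒x≡y x u∈⁅x⁆ = contradiction (_ , v∈Ru) Rx-empty
      1≤0 : 1 ≤ 0
      1≤0 = begin
        1                  ≡⟨ ∣⁅x⁆∣≡1 x ⟨
        ∣ ⁅ x ⁆ ∣          ≤⟨ hall ⁅ x ⁆ ⁅x⁆⊆B ⟩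
        ∣ image R ⁅ x ⁆ ∣  ≤⟨ p⊆q⇒∣p∣≤∣q∣ image⊆⊥ ⟩
        ∣ ⊥ {n} ∣          ≡⟨ ∣⊥∣≡0 n ⟩
        0                  ∎
        where open ≤-Reasoning

    ∈R⇒≡g : ∀ {x y} → x ∈ B → y ∈ R x → y ≡ g x
    ∈R⇒≡g {x} {y} x∈B y∈Rx with y ≟ᶠ g x
    ... | yes y≡gx = y≡gx
    ... | no  y≢gx = contradiction (x , x∈B , y , g x , y≢gx , y∈Rx , g-∈ x∈B) unambiguous

    g-injective : InjectiveOn B g
    g-injective {x} {x′} x∈B x′∈B gx≡gx′ with x ≟ᶠ x′
    ... | yes x≡x′ = x≡x′
    ... | no  x≢x′ = contradiction ∣T∣≤1 (<⇒≱ 1<∣T∣)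
      where
      T : Subset n
      T = ⁅ x ⁆ ∪ ⁅ x′ ⁆
      1<∣T∣ : 1 < ∣ T ∣
      1<∣T∣ = begin-strict
        1                       <⟨ s≤s (s≤s z≤n) ⟩
        2                       ≡⟨ cong₂ _+_ (∣⁅x⁆∣≡1 x) (∣⁅x⁆∣≡1 x′) ⟨
        ∣ ⁅ x ⁆ ∣ + ∣ ⁅ x′ ⁆ ∣  ≤⟨ disjoint⇒∣p∣+∣q∣≤∣p∪q∣ ⁅ x ⁆ ⁅ x′ ⁆ ⁅x⁆#⁅x′⁆ ⟩
        ∣ T ∣                   ∎
        where
        open ≤-Reasoning
        ⁅x⁆#⁅x′⁆ : Disjoint ⁅ x ⁆ ⁅ x′ ⁆
        ⁅x⁆#⁅x′⁆ u∈⁅x⁆ u∈⁅x′⁆ = x≢x′ (trans (sym (x∈⁅y⁆⇒x≡y x u∈⁅x⁆)) (x∈⁅y⁆⇒x≡y x′ u∈⁅x′⁆))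
      T⊆B : T ⊆ B
      T⊆B u∈T with x∈p∪q⁻ ⁅ x ⁆ ⁅ x′ ⁆ u∈T
      ... | inj₁ u∈⁅x⁆  rewrite x∈⁅y⁆⇒x≡y x u∈⁅x⁆ = x∈B
      ... | inj₂ u∈⁅x′⁆ rewrite x∈⁅y⁆⇒x≡y x′ u∈⁅x′⁆ = x′∈B
      image⊆⁅gx⁆ : image R T ⊆ ⁅ g x ⁆
      image⊆⁅gx⁆ v∈ with ∈image⁻ R v∈
      ... | u , u∈T , v∈Ru with x∈p∪q⁻ ⁅ x ⁆ ⁅ x′ ⁆ u∈T
      ...   | inj₁ u∈⁅x⁆  rewrite x∈⁅y⁆⇒x≡y x u∈⁅x⁆ | ∈R⇒≡g x∈B v∈Ru = x∈⁅x⁆ (g x)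
      ...   | inj₂ u∈⁅x′⁆ rewrite x∈⁅y⁆⇒x≡y x′ u∈⁅x′⁆ | ∈R⇒≡g x′∈B v∈Ru | gx≡gx′ = x∈⁅x⁆ (g x′)
      ∣T∣≤1 : ∣ T ∣ ≤ 1
      ∣T∣≤1 = ≤-trans (hall T T⊆B) (≤-trans (p⊆q⇒∣p∣≤∣q∣ image⊆⁅gx⁆) (≤-reflexive (∣⁅x⁆∣≡1 (g x))))

    sdr : SDR R
    sdr = g , g-∈ , g-injective

  sdr-delete⇒sdr : ∀ R x y → SDR (delete R x y) → SDR R
  sdr-delete⇒sdr R x y (g , g-∈ , g-injective) = g , delete-⊆ R x y _ ∘ g-∈ , g-injective

  hall-acc : ∀ R → Acc _<_ (weight R) → HallCondition R → SDR R
  hall-acc R (acc rec) hall with ambiguous? R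
  ... | no unambiguous = Unambiguous.sdr R hall unambiguous
  ... | yes (x , x∈B , y₁ , y₂ , y₁≢y₂ , y₁∈Rx , y₂∈Rx)
      with hallCondition? (delete R x y₁) | hallCondition? (delete R x y₂)
  ...   | inj₁ hall₁ | _ =
          sdr-delete⇒sdr R x y₁ (hall-acc (delete R x y₁) (rec (weight-delete R y₁∈Rx)) hall₁)
  ...   | inj₂ _ | inj₁ hall₂ =
          sdr-delete⇒sdr R x y₂ (hall-acc (delete R x y₂) (rec (weight-delete R y₂∈Rx)) hall₂)
  ...   | inj₂ (_ , deficient₁) | inj₂ (_ , deficient₂) =
          contradiction deficient₂ (deficient-deletes⇒⊥ hall y₁≢y₂ deficient₁)

  hall-theorem : ∀ R → HallCondition R → SDR R
  hall-theorem R = hall-acc R (<-wellFounded (weight R))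

-- Independent sets, matchings and critical sets

m+m≤n+n⇒m≤n : ∀ {m n} → m + m ≤ n + n → m ≤ n
m+m≤n+n⇒m≤n m+m≤n+n = ≮⇒≥ λ n<m → <⇒≱ (+-mono-< n<m n<m) m+m≤n+n

[a-b]≤[c-e]⇔a+e≤c+b : ∀ a b c e → ℤ.+ a ℤ.- ℤ.+ b ℤ.≤ ℤ.+ c ℤ.- ℤ.+ e ⇔ a + e ≤ c + b
[a-b]≤[c-e]⇔a+e≤c+b a b c e = mk⇔
  (λ le → ℤ.drop‿+≤+ (subst₂ ℤ._≤_ lhs≡ rhs≡ (ℤ.+-monoˡ-≤ k le)))
  (λ le → cancel (subst₂ ℤ._≤_ (sym lhs≡) (sym rhs≡) (ℤ.+≤+ le)))
  where
  k : ℤ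
  k = ℤ.+ b ℤ.+ ℤ.+ e
  lhs≡ : (ℤ.+ a ℤ.- ℤ.+ b) ℤ.+ k ≡ ℤ.+ (a + e)
  lhs≡ = x-y+[y+z]≡x+z (ℤ.+ a) (ℤ.+ b) (ℤ.+ e)
    where
    x-y+[y+z]≡x+z : ∀ x y z → (x ℤ.- y) ℤ.+ (y ℤ.+ z) ≡ x ℤ.+ z
    x-y+[y+z]≡x+z = solve-∀
  rhs≡ : (ℤ.+ c ℤ.- ℤ.+ e) ℤ.+ k ≡ ℤ.+ (c + b)
  rhs≡ = x-z+[y+z]≡x+y (ℤ.+ c) (ℤ.+ b) (ℤ.+ e)
    where
    x-z+[y+z]≡x+y : ∀ x y z → (x ℤ.- z) ℤ.+ (y ℤ.+ z) ≡ x ℤ.+ y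
    x-z+[y+z]≡x+y = solve-∀
  cancel : ∀ {i j} → i ℤ.+ k ℤ.≤ j ℤ.+ k → i ℤ.≤ j
  cancel {i} {j} le = subst₂ ℤ._≤_ (i+k-k≡i i k) (i+k-k≡i j k) (ℤ.+-monoˡ-≤ (ℤ.- k) le)
    where
    i+k-k≡i : ∀ i k → (i ℤ.+ k) ℤ.- k ≡ i
    i+k-k≡i = solve-∀

module _ (G : Graph) where
  open Graph G using (n; adj; irrefl)
  open import Data.List.Membership.DecPropositional (_≟ᶠ_ {n}) using () renaming (_∈?_ to _∈ₗ?_)

  ∈N⁺ : ∀ {X u v} → u ∈ X → adj u v ≡ true → v ∈ N G X
  ∈N⁺ {X} u∈X adj-uv = ∈tabulate⁺ (λ v → any? λ u → (u ∈? X) ×-dec (adj u v ≟ᵇ true)) (_ , u∈X , adj-uv)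

  ∈N⁻ : ∀ {X v} → v ∈ N G X → ∃ λ u → u ∈ X × adj u v ≡ true
  ∈N⁻ {X} = ∈tabulate⁻ (λ v → any? λ u → (u ∈? X) ×-dec (adj u v ≟ᵇ true))

  N-mono : ∀ {X Y} → X ⊆ Y → N G X ⊆ N G Y
  N-mono X⊆Y v∈NX = let u , u∈X , adj-uv = ∈N⁻ v∈NX in ∈N⁺ (X⊆Y u∈X) adj-uv

  independent⇒N#S : ∀ {S} → Independent G S → Disjoint (N G S) S
  independent⇒N#S {S} S-indep {v} v∈NS v∈S with ∈N⁻ v∈NS
  ... | u , u∈S , adj-uv = case trans (sym adj-uv) (S-indep u v u∈S v∈S) of λ ()

  ∉N⇒non-adjacent : ∀ {X u v} → u ∈ X → v ∉ N G X → adj u v ≡ false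
  ∉N⇒non-adjacent {u = u} {v} u∈X v∉NX with adj u v in adj-uv
  ... | true  = contradiction (∈N⁺ u∈X adj-uv) v∉NX
  ... | false = refl

  ⁅⁆-independent : ∀ v → Independent G ⁅ v ⁆
  ⁅⁆-independent v a b a∈ b∈ rewrite x∈⁅y⁆⇒x≡y v a∈ | x∈⁅y⁆⇒x≡y v b∈ = irrefl v

  independent-⊆ : ∀ {X Y} → X ⊆ Y → Independent G Y → Independent G X
  independent-⊆ X⊆Y Y-indep u v u∈X v∈X = Y-indep u v (X⊆Y u∈X) (X⊆Y v∈X)

  ∪-independent : ∀ {X Y} → Independent G X → Independent G Y →
                  (∀ {u v} → u ∈ X → v ∈ Y → adj u v ≡ false) → Independent G (X ∪ Y)
  ∪-independent {X} {Y} X-indep Y-indep X≁Y a b a∈ b∈ with x∈p∪q⁻ X Y a∈ | x∈p∪q⁻ X Y b∈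
  ... | inj₁ a∈X | inj₁ b∈X = X-indep a b a∈X b∈X
  ... | inj₁ a∈X | inj₂ b∈Y = X≁Y a∈X b∈Y
  ... | inj₂ a∈Y | inj₁ b∈X = trans (Graph.sym G a b) (X≁Y b∈X a∈Y)
  ... | inj₂ a∈Y | inj₂ b∈Y = Y-indep a b a∈Y b∈Y

  maxIndependent⇒∁⊆N : ∀ {S} → MaxIndependent G S → ∁ S ⊆ N G S
  maxIndependent⇒∁⊆N {S} (S-indep , S-max) {v} v∈∁S with v ∈? N G S
  ... | yes v∈NS = v∈NS
  ... | no  v∉NS = contradiction (S-max (S ∪ ⁅ v ⁆) S∪v-indep) (<⇒≱ ∣S∣<∣S∪v∣)
    where
    S∪v-indep : Independent G (S ∪ ⁅ v ⁆)
    S∪v-indep = ∪-independent S-indep (⁅⁆-independent v) λ u∈S w∈⁅v⁆ →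
      subst (λ w → adj _ w ≡ false) (sym (x∈⁅y⁆⇒x≡y v w∈⁅v⁆)) (∉N⇒non-adjacent u∈S v∉NS)
    ∣S∣<∣S∪v∣ : ∣ S ∣ < ∣ S ∪ ⁅ v ⁆ ∣
    ∣S∣<∣S∪v∣ = begin-strict
      ∣ S ∣              <⟨ n<1+n _ ⟩
      suc ∣ S ∣          ≡⟨ +-comm 1 _ ⟩
      ∣ S ∣ + 1          ≡⟨ cong (∣ S ∣ +_) (∣⁅x⁆∣≡1 v) ⟨
      ∣ S ∣ + ∣ ⁅ v ⁆ ∣  ≤⟨ disjoint⇒∣p∣+∣q∣≤∣p∪q∣ S ⁅ v ⁆ S#⁅v⁆ ⟩
      ∣ S ∪ ⁅ v ⁆ ∣      ∎
      where
      open ≤-Reasoning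
      S#⁅v⁆ : Disjoint S ⁅ v ⁆
      S#⁅v⁆ u∈S u∈⁅v⁆ = x∈∁p⇒x∉p v∈∁S (subst (_∈ S) (x∈⁅y⁆⇒x≡y v u∈⁅v⁆) u∈S)

  maxIndependent⇒N≡∁ : ∀ {S} → MaxIndependent G S → N G S ≡ ∁ S
  maxIndependent⇒N≡∁ S-max@(S-indep , _) =
    ⊆-antisym (x∉p⇒x∈∁p ∘ independent⇒N#S S-indep) (maxIndependent⇒∁⊆N S-max)

  mate : List (Fin n × Fin n) → Fin n → Fin n
  mate []            z = z
  mate ((u , v) ∷ M) z = if does (z ≟ᶠ u) then v else if does (z ≟ᶠ v) then u else mate M z

  ∈-tail-endpoints : ∀ {u v z M} → z ∈ₗ endpoints G ((u , v) ∷ M) → z ≢ u → z ≢ v → z ∈ₗ endpoints G M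
  ∈-tail-endpoints (hereₗ z≡u)                  z≢u z≢v = contradiction z≡u z≢u
  ∈-tail-endpoints (thereₗ (hereₗ z≡v))         z≢u z≢v = contradiction z≡v z≢v
  ∈-tail-endpoints (thereₗ (thereₗ z∈endpoints)) z≢u z≢v = z∈endpoints

  mate-adjacent : ∀ {M z} → IsMatching G M → z ∈ₗ endpoints G M → adj z (mate M z) ≡ true
  mate-adjacent {(u , v) ∷ M} {z} (adj-uv ∷ adjs , _ ∷ _ ∷ unique) z∈ with z ≟ᶠ u
  ... | yes refl = adj-uv
  ... | no  z≢u with z ≟ᶠ v
  ...   | yes refl = trans (Graph.sym G z u) adj-uv
  ...   | no  z≢v  = mate-adjacent {M} (adjs , unique) (∈-tail-endpoints {M = M} z∈ z≢u z≢v)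

  mate-∈-endpoints : ∀ {M z} → z ∈ₗ endpoints G M → mate M z ∈ₗ endpoints G M
  mate-∈-endpoints {(u , v) ∷ M} {z} z∈ with z ≟ᶠ u
  ... | yes refl = thereₗ (hereₗ refl)
  ... | no  z≢u with z ≟ᶠ v
  ...   | yes refl = hereₗ refl
  ...   | no  z≢v  = thereₗ (thereₗ (mate-∈-endpoints {M} (∈-tail-endpoints {M = M} z∈ z≢u z≢v)))

  mate-skip : ∀ {u v z} M → z ≢ u → z ≢ v → mate ((u , v) ∷ M) z ≡ mate M z
  mate-skip {u} {v} {z} M z≢u z≢v rewrite dec-false (z ≟ᶠ u) z≢u | dec-false (z ≟ᶠ v) z≢v = refl

  mate-involutive : ∀ {M z} → Unique (endpoints G M) → z ∈ₗ endpoints G M → mate M (mate M z) ≡ z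
  mate-involutive {(u , v) ∷ M} {z} (u∉ ∷ v∉ ∷ unique) z∈ with z ≟ᶠ u
  ... | yes refl rewrite dec-false (v ≟ᶠ z) (All.lookup u∉ (hereₗ refl) ∘ sym) | dec-true (v ≟ᶠ v) refl = refl
  ... | no  z≢u with z ≟ᶠ v
  ...   | yes refl rewrite dec-true (u ≟ᶠ u) refl = refl
  ...   | no  z≢v = begin
    mate ((u , v) ∷ M) (mate M z)  ≡⟨ mate-skip M (λ { refl → All.lookup u∉ (thereₗ w∈) refl })
                                                    (λ { refl → All.lookup v∉ w∈ refl }) ⟩
    mate M (mate M z)              ≡⟨ mate-involutive {M} unique z∈M ⟩
    z                              ∎
    where
    open ≡-Reasoning
    z∈M : z ∈ₗ endpoints G M
    z∈M = ∈-tail-endpoints {M = M} z∈ z≢u z≢v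
    w∈ : mate M z ∈ₗ endpoints G M
    w∈ = mate-∈-endpoints {M} z∈M

  mate-injective : ∀ {M x y} → Unique (endpoints G M) → x ∈ₗ endpoints G M → y ∈ₗ endpoints G M →
                   mate M x ≡ mate M y → x ≡ y
  mate-injective {M} {x} {y} unique x∈ y∈ mx≡my = begin
    x                  ≡⟨ mate-involutive {M} unique x∈ ⟨
    mate M (mate M x)  ≡⟨ cong (mate M) mx≡my ⟩
    mate M (mate M y)  ≡⟨ mate-involutive {M} unique y∈ ⟩
    y                  ∎
    where open ≡-Reasoning

  length-endpoints : ∀ M → length (endpoints G M) ≡ length M + length M
  length-endpoints []      = refl
  length-endpoints (_ ∷ M) = trans (cong (2 +_) (length-endpoints M)) (cong suc (sym (+-suc _ _)))

  matching-bound : ∀ {M} → IsMatching G M → ∀ Y → ∣ Y ∣ + (length M + length M) ≤ n + ∣ N G Y ∣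
  matching-bound {M} M-matching@(_ , unique) Y = begin
    ∣ Y ∣ + (length M + length M)    ≡⟨ cong (∣ Y ∣ +_) (length-endpoints M) ⟨
    ∣ Y ∣ + length (endpoints G M)   ≤⟨ +-mono-≤ ∣Y∣≤∣Y∩E∣+∣∁E∣ (length≤∣Q∣ E unique endpoints⊆E) ⟩
    (∣ Y ∩ E ∣ + ∣ ∁ E ∣) + ∣ E ∣    ≡⟨ +-assoc ∣ Y ∩ E ∣ _ _ ⟩
    ∣ Y ∩ E ∣ + (∣ ∁ E ∣ + ∣ E ∣)    ≡⟨ cong (∣ Y ∩ E ∣ +_) (∣∁p∣+∣p∣≡n E) ⟩
    ∣ Y ∩ E ∣ + n                    ≤⟨ +-monoˡ-≤ n ∣Y∩E∣≤∣NY∣ ⟩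
    ∣ N G Y ∣ + n                    ≡⟨ +-comm _ n ⟩
    n + ∣ N G Y ∣                    ∎
    where
    open ≤-Reasoning
    E : Subset n
    E = tabulate (does ∘ (_∈ₗ? endpoints G M))
    endpoints⊆E : All (_∈ E) (endpoints G M)
    endpoints⊆E = All.tabulate (∈tabulate⁺ (_∈ₗ? endpoints G M))
    ∣Y∣≤∣Y∩E∣+∣∁E∣ : ∣ Y ∣ ≤ ∣ Y ∩ E ∣ + ∣ ∁ E ∣
    ∣Y∣≤∣Y∩E∣+∣∁E∣ = ≤-trans (p⊆q⇒∣p∣≤∣q∣ Y⊆) (∣p∪q∣≤∣p∣+∣q∣ (Y ∩ E) (∁ E))
      where
      Y⊆ : Y ⊆ (Y ∩ E) ∪ ∁ E
      Y⊆ {z} z∈Y with z ∈? E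
      ... | yes z∈E = p⊆p∪q (∁ E) (x∈p∩q⁺ (z∈Y , z∈E))
      ... | no  z∉E = q⊆p∪q (Y ∩ E) (∁ E) (x∉p⇒x∈∁p z∉E)
    ∈endpoints : ∀ {z} → z ∈ Y ∩ E → z ∈ₗ endpoints G M
    ∈endpoints = ∈tabulate⁻ (_∈ₗ? endpoints G M) ∘ proj₂ ∘ x∈p∩q⁻ Y E
    ∣Y∩E∣≤∣NY∣ : ∣ Y ∩ E ∣ ≤ ∣ N G Y ∣
    ∣Y∩E∣≤∣NY∣ = injection⇒∣p∣≤∣q∣ (Y ∩ E) (N G Y) (mate M)
      (λ z∈ → ∈N⁺ (proj₁ (x∈p∩q⁻ Y E z∈)) (mate-adjacent M-matching (∈endpoints z∈)))
      (λ x∈ y∈ → mate-injective {M} unique (∈endpoints x∈) (∈endpoints y∈))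

  Critical⇔ : ∀ {X} → Critical G X ⇔ (∀ Y → ∣ Y ∣ + ∣ N G X ∣ ≤ ∣ X ∣ + ∣ N G Y ∣)
  Critical⇔ {X} = mk⇔ (λ crit Y → Equivalence.to (d≤d⇔ Y) (crit Y))
                      (λ bound Y → Equivalence.from (d≤d⇔ Y) (bound Y))
    where
    d≤d⇔ : ∀ Y → d G Y ℤ.≤ d G X ⇔ ∣ Y ∣ + ∣ N G X ∣ ≤ ∣ X ∣ + ∣ N G Y ∣
    d≤d⇔ Y = [a-b]≤[c-e]⇔a+e≤c+b (∣ Y ∣) (∣ N G Y ∣) (∣ X ∣) (∣ N G X ∣)

  length≤∣∁S∣ : ∀ {S M} → Independent G S → IsMatching G M → length M ≤ ∣ ∁ S ∣
  length≤∣∁S∣ {S} {M} S-indep M-matching = m+m≤n+n⇒m≤n (+-cancelˡ-≤ ∣ S ∣ _ _ (begin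
    ∣ S ∣ + (length M + length M)     ≤⟨ matching-bound M-matching S ⟩
    n + ∣ N G S ∣                     ≤⟨ +-monoʳ-≤ n (p⊆q⇒∣p∣≤∣q∣ (x∉p⇒x∈∁p ∘ independent⇒N#S S-indep)) ⟩
    n + ∣ ∁ S ∣                       ≡⟨ cong (_+ ∣ ∁ S ∣) (∣∁p∣+∣p∣≡n S) ⟨
    (∣ ∁ S ∣ + ∣ S ∣) + ∣ ∁ S ∣       ≡⟨ cong (_+ ∣ ∁ S ∣) (+-comm ∣ ∁ S ∣ ∣ S ∣) ⟩
    (∣ S ∣ + ∣ ∁ S ∣) + ∣ ∁ S ∣       ≡⟨ +-assoc ∣ S ∣ _ _ ⟩
    ∣ S ∣ + (∣ ∁ S ∣ + ∣ ∁ S ∣)       ∎))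
    where open ≤-Reasoning

  maxIndependent-∣∣ : ∀ {S T} → MaxIndependent G S → MaxIndependent G T → ∣ S ∣ ≡ ∣ T ∣
  maxIndependent-∣∣ (S-indep , S-max) (T-indep , T-max) = ≤-antisym (T-max _ S-indep) (S-max _ T-indep)

  königEgervary⇒critical : ∀ {S} → KönigEgervary G → MaxIndependent G S → Critical G S
  königEgervary⇒critical {S} (S₀ , M , S₀-max , (M-matching , _) , ∣S₀∣+μ≡n) S-max =
    Equivalence.from Critical⇔ λ Y → +-cancelʳ-≤ μ _ _ (begin
      (∣ Y ∣ + ∣ N G S ∣) + μ    ≡⟨ cong (λ k → (∣ Y ∣ + k) + μ) ∣NS∣≡μ ⟩
      (∣ Y ∣ + μ) + μ            ≡⟨ +-assoc ∣ Y ∣ μ μ ⟩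
      ∣ Y ∣ + (μ + μ)            ≤⟨ matching-bound M-matching Y ⟩
      n + ∣ N G Y ∣              ≡⟨ cong (_+ ∣ N G Y ∣) n≡∣S∣+μ ⟩
      (∣ S ∣ + μ) + ∣ N G Y ∣    ≡⟨ +-assoc ∣ S ∣ μ _ ⟩
      ∣ S ∣ + (μ + ∣ N G Y ∣)    ≡⟨ cong (∣ S ∣ +_) (+-comm μ _) ⟩
      ∣ S ∣ + (∣ N G Y ∣ + μ)    ≡⟨ +-assoc ∣ S ∣ _ μ ⟨
      (∣ S ∣ + ∣ N G Y ∣) + μ    ∎)
    where
    open ≤-Reasoning
    μ : ℕ
    μ = length M
    n≡∣S∣+μ : n ≡ ∣ S ∣ + μ
    n≡∣S∣+μ = trans (sym ∣S₀∣+μ≡n) (cong (_+ μ) (maxIndependent-∣∣ S₀-max S-max))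
    ∣NS∣≡μ : ∣ N G S ∣ ≡ μ
    ∣NS∣≡μ = +-cancelʳ-≡ ∣ S ∣ _ _ (begin-equality
      ∣ N G S ∣ + ∣ S ∣  ≡⟨ cong (λ X → ∣ X ∣ + ∣ S ∣) (maxIndependent⇒N≡∁ S-max) ⟩
      ∣ ∁ S ∣ + ∣ S ∣    ≡⟨ ∣∁p∣+∣p∣≡n S ⟩
      n                  ≡⟨ n≡∣S∣+μ ⟩
      ∣ S ∣ + μ          ≡⟨ +-comm ∣ S ∣ μ ⟩
      μ + ∣ S ∣          ∎)

  ∣A∣≤∣NA∩S∣ : ∀ {S A} → MaxIndependent G S → Independent G A → Disjoint A S → ∣ A ∣ ≤ ∣ N G A ∩ S ∣
  ∣A∣≤∣NA∩S∣ {S} {A} (S-indep , S-max) A-indep A#S = +-cancelʳ-≤ ∣ S ─ N G A ∣ _ _ (begin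
    ∣ A ∣ + ∣ S ─ N G A ∣          ≤⟨ disjoint⇒∣p∣+∣q∣≤∣p∪q∣ A (S ─ N G A) (λ z∈A → A#S z∈A ∘ p─q⊆p S _) ⟩
    ∣ A ∪ (S ─ N G A) ∣            ≤⟨ S-max _ A∪[S─NA]-indep ⟩
    ∣ S ∣                          ≤⟨ p⊆q⇒∣p∣≤∣q∣ S⊆ ⟩
    ∣ (N G A ∩ S) ∪ (S ─ N G A) ∣  ≤⟨ ∣p∪q∣≤∣p∣+∣q∣ (N G A ∩ S) (S ─ N G A) ⟩
    ∣ N G A ∩ S ∣ + ∣ S ─ N G A ∣  ∎)
    where
    open ≤-Reasoning
    A∪[S─NA]-indep : Independent G (A ∪ (S ─ N G A))
    A∪[S─NA]-indep = ∪-independent A-indep (independent-⊆ (p─q⊆p S (N G A)) S-indep)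
                       λ a∈A b∈S─NA → ∉N⇒non-adjacent a∈A (x∈p─q⇒x∉q S (N G A) b∈S─NA)
    S⊆ : S ⊆ (N G A ∩ S) ∪ (S ─ N G A)
    S⊆ {z} z∈S with z ∈? N G A
    ... | yes z∈NA = p⊆p∪q (S ─ N G A) (x∈p∩q⁺ (z∈NA , z∈S))
    ... | no  z∉NA = q⊆p∪q (N G A ∩ S) (S ─ N G A) (x∈p∧x∉q⇒x∈p─q z∈S z∉NA)

  critical⇒∣T∣+∣NA′∩S∣≤∣A′∣+∣NT∩S∣ :
    ∀ {S A T} → MaxIndependent G S → Critical G (S ∪ A) → T ⊆ ∁ S →
    ∣ T ∣ + ∣ N G (A ∩ ∁ S) ∩ S ∣ ≤ ∣ A ∩ ∁ S ∣ + ∣ N G T ∩ S ∣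
  critical⇒∣T∣+∣NA′∩S∣≤∣A′∣+∣NT∩S∣ {S} {A} {T} S-max@(S-indep , _) crit T⊆∁S =
    +-cancelˡ-≤ (∣ S ∣ + ∣ ∁ S ∣) _ _ (begin
      (∣ S ∣ + ∣ ∁ S ∣) + (∣ T ∣ + ∣ NA′∩S ∣)   ≡⟨ interchange ∣ S ∣ _ _ _ ⟩
      (∣ S ∣ + ∣ T ∣) + (∣ ∁ S ∣ + ∣ NA′∩S ∣)   ≤⟨ +-mono-≤ ∣S∣+∣T∣≤∣S∪T∣ ∣∁S∣+∣NA′∩S∣≤∣N[S∪A]∣ ⟩
      ∣ S ∪ T ∣ + ∣ N G (S ∪ A) ∣                ≤⟨ Equivalence.to Critical⇔ crit (S ∪ T) ⟩
      ∣ S ∪ A ∣ + ∣ N G (S ∪ T) ∣                ≤⟨ +-mono-≤ ∣S∪A∣≤∣S∣+∣A′∣ ∣N[S∪T]∣≤∣∁S∣+∣NT∩S∣ ⟩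
      (∣ S ∣ + ∣ A′ ∣) + (∣ ∁ S ∣ + ∣ N G T ∩ S ∣) ≡⟨ interchange ∣ S ∣ _ _ _ ⟩
      (∣ S ∣ + ∣ ∁ S ∣) + (∣ A′ ∣ + ∣ N G T ∩ S ∣) ∎)
    where
    open ≤-Reasoning
    A′ NA′∩S : Subset n
    A′ = A ∩ ∁ S
    NA′∩S = N G A′ ∩ S
    ∁S#S : Disjoint (∁ S) S
    ∁S#S = x∈∁p⇒x∉p
    ∣S∣+∣T∣≤∣S∪T∣ : ∣ S ∣ + ∣ T ∣ ≤ ∣ S ∪ T ∣
    ∣S∣+∣T∣≤∣S∪T∣ = disjoint⇒∣p∣+∣q∣≤∣p∪q∣ S T (λ z∈S z∈T → ∁S#S (T⊆∁S z∈T) z∈S)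
    ∣∁S∣+∣NA′∩S∣≤∣N[S∪A]∣ : ∣ ∁ S ∣ + ∣ NA′∩S ∣ ≤ ∣ N G (S ∪ A) ∣
    ∣∁S∣+∣NA′∩S∣≤∣N[S∪A]∣ = ≤-trans
      (disjoint⇒∣p∣+∣q∣≤∣p∪q∣ (∁ S) NA′∩S (λ z∈∁S → ∁S#S z∈∁S ∘ proj₂ ∘ x∈p∩q⁻ (N G A′) S))
      (p⊆q⇒∣p∣≤∣q∣ λ z∈ → [ N-mono (p⊆p∪q A) ∘ maxIndependent⇒∁⊆N S-max
                            , N-mono (q⊆p∪q S A ∘ p∩q⊆p A (∁ S)) ∘ proj₁ ∘ x∈p∩q⁻ (N G A′) S
                            ]′ (x∈p∪q⁻ (∁ S) NA′∩S z∈))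
    ∣S∪A∣≤∣S∣+∣A′∣ : ∣ S ∪ A ∣ ≤ ∣ S ∣ + ∣ A′ ∣
    ∣S∪A∣≤∣S∣+∣A′∣ = ≤-trans (p⊆q⇒∣p∣≤∣q∣ S∪A⊆S∪A′) (∣p∪q∣≤∣p∣+∣q∣ S A′)
      where
      S∪A⊆S∪A′ : S ∪ A ⊆ S ∪ A′
      S∪A⊆S∪A′ {z} z∈ with z ∈? S | x∈p∪q⁻ S A z∈
      ... | yes z∈S | _        = p⊆p∪q A′ z∈S
      ... | no  z∉S | inj₁ z∈S = contradiction z∈S z∉S
      ... | no  z∉S | inj₂ z∈A = q⊆p∪q S A′ (x∈p∩q⁺ (z∈A , x∉p⇒x∈∁p z∉S))
    ∣N[S∪T]∣≤∣∁S∣+∣NT∩S∣ : ∣ N G (S ∪ T) ∣ ≤ ∣ ∁ S ∣ + ∣ N G T ∩ S ∣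
    ∣N[S∪T]∣≤∣∁S∣+∣NT∩S∣ = ≤-trans (p⊆q⇒∣p∣≤∣q∣ N[S∪T]⊆) (∣p∪q∣≤∣p∣+∣q∣ (∁ S) (N G T ∩ S))
      where
      N[S∪T]⊆ : N G (S ∪ T) ⊆ ∁ S ∪ (N G T ∩ S)
      N[S∪T]⊆ {z} z∈N with z ∈? S | ∈N⁻ z∈N
      ... | no  z∉S | _ = p⊆p∪q (N G T ∩ S) (x∉p⇒x∈∁p z∉S)
      ... | yes z∈S | u , u∈S∪T , adj-uz with x∈p∪q⁻ S T u∈S∪T
      ...   | inj₁ u∈S = contradiction z∈S (independent⇒N#S S-indep (∈N⁺ u∈S adj-uz))
      ...   | inj₂ u∈T = q⊆p∪q (∁ S) (N G T ∩ S) (x∈p∩q⁺ (∈N⁺ u∈T adj-uz , z∈S))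

  critical⇒hall : ∀ {S A} → MaxIndependent G S → Independent G A → Critical G (S ∪ A) →
                  ∀ T → T ⊆ ∁ S → ∣ T ∣ ≤ ∣ N G T ∩ S ∣
  critical⇒hall {S} {A} S-max A-indep crit T T⊆∁S = +-cancelʳ-≤ ∣ N G A′ ∩ S ∣ _ _ (begin
    ∣ T ∣ + ∣ N G A′ ∩ S ∣          ≤⟨ critical⇒∣T∣+∣NA′∩S∣≤∣A′∣+∣NT∩S∣ S-max crit T⊆∁S ⟩
    ∣ A′ ∣ + ∣ N G T ∩ S ∣          ≤⟨ +-monoˡ-≤ _ (∣A∣≤∣NA∩S∣ S-max A′-indep A′#S) ⟩
    ∣ N G A′ ∩ S ∣ + ∣ N G T ∩ S ∣  ≡⟨ +-comm ∣ N G A′ ∩ S ∣ _ ⟩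
    ∣ N G T ∩ S ∣ + ∣ N G A′ ∩ S ∣  ∎)
    where
    open ≤-Reasoning
    A′ : Subset n
    A′ = A ∩ ∁ S
    A′-indep : Independent G A′
    A′-indep = independent-⊆ (p∩q⊆p A (∁ S)) A-indep
    A′#S : Disjoint A′ S
    A′#S = x∈∁p⇒x∉p ∘ p∩q⊆q A (∁ S)

  pairing : (Fin n → Fin n) → List (Fin n) → List (Fin n × Fin n)
  pairing g = map (λ x → x , g x)

  ∈-endpoints-pairing⁻ : ∀ {g z} xs → z ∈ₗ endpoints G (pairing g xs) → ∃ λ x → x ∈ₗ xs × (z ≡ x ⊎ z ≡ g x)
  ∈-endpoints-pairing⁻ (x ∷ xs) (hereₗ z≡x)           = x , hereₗ refl , inj₁ z≡x
  ∈-endpoints-pairing⁻ (x ∷ xs) (thereₗ (hereₗ z≡gx)) = x , hereₗ refl , inj₂ z≡gx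
  ∈-endpoints-pairing⁻ (x ∷ xs) (thereₗ (thereₗ z∈))  =
    let x′ , x′∈xs , z≡ = ∈-endpoints-pairing⁻ xs z∈ in x′ , thereₗ x′∈xs , z≡

  pairing-isMatching : ∀ {B g} xs → Unique xs → All (_∈ B) xs → InjectiveOn B g →
                       (∀ {x} → x ∈ B → g x ∉ B) → (∀ {x} → x ∈ B → adj x (g x) ≡ true) →
                       IsMatching G (pairing g xs)
  pairing-isMatching []       [] [] g-inj g[B]#B adj-g = [] , []
  pairing-isMatching {B} {g} (x ∷ xs) (x∉xs ∷ xs!) (x∈B ∷ xs⊆B) g-inj g[B]#B adj-g =
    let adjs , unique = pairing-isMatching xs xs! xs⊆B g-inj g[B]#B adj-g in
    adj-g x∈B ∷ adjs , ¬Any⇒All¬ _ x∉ ∷ ¬Any⇒All¬ _ gx∉ ∷ unique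
    where
    x∉ : ¬ x ∈ₗ (g x ∷ endpoints G (pairing g xs))
    x∉ (hereₗ x≡gx) = g[B]#B x∈B (subst (_∈ B) x≡gx x∈B)
    x∉ (thereₗ x∈) with ∈-endpoints-pairing⁻ xs x∈
    ... | x′ , x′∈xs , inj₁ x≡x′  = All.lookup x∉xs x′∈xs x≡x′
    ... | x′ , x′∈xs , inj₂ x≡gx′ = g[B]#B (All.lookup xs⊆B x′∈xs) (subst (_∈ B) x≡gx′ x∈B)
    gx∉ : ¬ g x ∈ₗ endpoints G (pairing g xs)
    gx∉ gx∈ with ∈-endpoints-pairing⁻ xs gx∈
    ... | x′ , x′∈xs , inj₁ gx≡x′  = g[B]#B x∈B (subst (_∈ B) (sym gx≡x′) (All.lookup xs⊆B x′∈xs))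
    ... | x′ , x′∈xs , inj₂ gx≡gx′ = All.lookup x∉xs x′∈xs (g-inj x∈B (All.lookup xs⊆B x′∈xs) gx≡gx′)

  NeighboursIn : Subset n → Family n
  NeighboursIn S x = N G ⁅ x ⁆ ∩ S

  sdr⇒königEgervary : ∀ {S} → MaxIndependent G S → Hall.SDR (∁ S) (NeighboursIn S) → KönigEgervary G
  sdr⇒königEgervary {S} S-max@(S-indep , _) (g , g-∈ , g-injective) =
    S , M , S-max , (M-matching , λ M′ M′-matching → ≤-trans (length≤∣∁S∣ S-indep M′-matching) ∣∁S∣≤length) ,
    (begin-equality
      ∣ S ∣ + length M   ≡⟨ cong (∣ S ∣ +_) (≤-antisym (length≤∣∁S∣ S-indep M-matching) ∣∁S∣≤length) ⟩
      ∣ S ∣ + ∣ ∁ S ∣    ≡⟨ +-comm ∣ S ∣ _ ⟩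
      ∣ ∁ S ∣ + ∣ S ∣    ≡⟨ ∣∁p∣+∣p∣≡n S ⟩
      n                  ∎)
    where
    open ≤-Reasoning
    ∁S-list : List (Fin n)
    ∁S-list = filter (_∈? ∁ S) (allFin n)
    M : List (Fin n × Fin n)
    M = pairing g ∁S-list
    adj-g : ∀ {x} → x ∈ ∁ S → adj x (g x) ≡ true
    adj-g {x} x∈∁S with ∈N⁻ (p∩q⊆p _ S (g-∈ x∈∁S))
    ... | u , u∈⁅x⁆ , adj-ugx rewrite x∈⁅y⁆⇒x≡y x u∈⁅x⁆ = adj-ugx
    M-matching : IsMatching G M
    M-matching = pairing-isMatching ∁S-list (filter⁺ (_∈? ∁ S) (allFin⁺ n)) (all-filter (_∈? ∁ S) (allFin n))
                   g-injective (x∈p⇒x∉∁p ∘ p∩q⊆q _ S ∘ g-∈) adj-g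
    ∣∁S∣≤length : ∣ ∁ S ∣ ≤ length M
    ∣∁S∣≤length = begin
      ∣ ∁ S ∣           ≤⟨ ∣P∣≤length (∁ S) ∁S-list (∈-filter⁺ (_∈? ∁ S) (∈-allFin _)) ⟩
      length ∁S-list    ≡⟨ length-map _ ∁S-list ⟨
      length M          ∎

  hall⇒königEgervary : ∀ {S} → MaxIndependent G S → (∀ T → T ⊆ ∁ S → ∣ T ∣ ≤ ∣ N G T ∩ S ∣) → KönigEgervary G
  hall⇒königEgervary {S} S-max hall = sdr⇒königEgervary S-max (hall-theorem (NeighboursIn S) hallR)
    where
    open Hall (∁ S)
    hallR : HallCondition (NeighboursIn S)
    hallR T T⊆∁S = ≤-trans (hall T T⊆∁S) (p⊆q⇒∣p∣≤∣q∣ NT∩S⊆image)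
      where
      NT∩S⊆image : N G T ∩ S ⊆ image (NeighboursIn S) T
      NT∩S⊆image z∈ with x∈p∩q⁻ (N G T) S z∈
      ... | z∈NT , z∈S with ∈N⁻ z∈NT
      ...   | u , u∈T , adj-uz = ∈image⁺ (NeighboursIn S) u∈T (x∈p∩q⁺ (∈N⁺ (x∈⁅x⁆ u) adj-uz , z∈S))

  independent? : ∀ S → Dec (Independent G S)
  independent? S = all? λ u → all? λ v → (u ∈? S) →-dec (v ∈? S) →-dec (adj u v ≟ᵇ false)

  ⊥-independent : Independent G ⊥
  ⊥-independent u v u∈⊥ = contradiction u∈⊥ ∉⊥

  maxIndependent-exists : ∃ (MaxIndependent G)
  maxIndependent-exists = maximum-subset independent? ⊥-independent

  CriticallyExtendable : Subset n → Set
  CriticallyExtendable S = Σ (Subset n) λ A → Independent G A × Critical G (S ∪ A)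

  königEgervary⇒extendable : KönigEgervary G → ∀ S → MaxIndependent G S → CriticallyExtendable S
  königEgervary⇒extendable KE S S-max =
    ⊥ , ⊥-independent , subst (Critical G) (sym (∪-identityʳ S)) (königEgervary⇒critical KE S-max)

  extendable⇒königEgervary : ∀ {S} → MaxIndependent G S → CriticallyExtendable S → KönigEgervary G
  extendable⇒königEgervary S-max (A , A-indep , crit) =
    hall⇒königEgervary S-max (critical⇒hall S-max A-indep crit)

corollary3p10 : (G : Graph) →
    (KönigEgervary G ⇔ (∀ (S : Subset (Graph.n G)) → MaxIndependent G S →
        Σ (Subset (Graph.n G)) λ A → Independent G A × Critical G (S ∪ A)))
    × (KönigEgervary G ⇔ Σ (Subset (Graph.n G)) λ S → Σ (Subset (Graph.n G)) λ A →
        MaxIndependent G S × Independent G A × Critical G (S ∪ A))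
corollary3p10 G =
  mk⇔ (königEgervary⇒extendable G)
      (λ ii → let S , S-max = maxIndependent-exists G in extendable⇒königEgervary G S-max (ii S S-max)) ,
  mk⇔ (λ KE → let S , S-max          = maxIndependent-exists G
                  A , A-indep , crit = königEgervary⇒extendable G KE S S-max
              in S , A , S-max , A-indep , crit)
      (λ (S , A , S-max , A-indep , crit) → extendable⇒königEgervary G S-max (A , A-indep , crit))
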